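{- Let $a,b$ be integers. If $\mathscr{G}(a,b)\neq\emptyset$, then $a\ge 0$, $a^2+4b\ge 4$ and $(a,b)\neq(0,1)$.
   Context: All graphs are finite, simple and undirected; eigenvalues are those of the adjacency matrix. An eigenvalue of a graph $G$ is a main eigenvalue if it has an eigenvector the sum of whose entries is nonzero. For integers $a,b$, $\mathscr{G}(a,b)$ denotes the set of connected graphs $G$ that have exactly two main eigenvalues and satisfy $\sum_{u\in N(v)}d(u)=a\,d(v)+b$ for every vertex $v\in V(G)$. -}

module Defs where

open import Level using (Level; _⊔_) renaming (suc to lsuc)
open import Data.Bool using (Bool; true; false)
open import Data.Nat as ℕ using (ℕ; zero; suc)
open import Data.Fin using (Fin; zero; suc)
open import Data.Vec using (Vec; []; _∷_)
open import Data.List using (List; []; _∷_)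
open import Data.Integer as ℤ using (ℤ; +_)
open import Data.Product using (Σ; ∃; _×_; _,_)
open import Data.Sum using (_⊎_)
open import Relation.Nullary using (¬_)
open import Relation.Binary.PropositionalEquality using (_≡_)
open import Relation.Binary.Structures using (IsTotalOrder)
open import Algebra.Bundles using (CommutativeRing)

-- Real closed fields (an abstract stand-in for ℝ; every real closed
-- field is elementarily equivalent to ℝ).

-- evalMonic (c₀ ∷ c₁ ∷ … ∷ c_{m-1}) x = c₀ + c₁ x + … + c_{m-1} x^{m-1} + x^m
module _ {c ℓ} (R : CommutativeRing c ℓ) where
  open CommutativeRing R using (Carrier; _+_; _*_; 1#)
  evalMonic : ∀ {m} → Vec Carrier m → Carrier → Carrier
  evalMonic []       x = 1#
  evalMonic (k ∷ ks) x = k + x * evalMonic ks x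

record RealClosedField c ℓ : Set (lsuc (c ⊔ ℓ)) where
  field
    commRing : CommutativeRing c ℓ
  open CommutativeRing commRing public hiding (ring)
  field
    _≤_          : Carrier → Carrier → Set ℓ
    isTotalOrder : IsTotalOrder _≈_ _≤_
    +-mono       : ∀ x y z → x ≤ y → (x + z) ≤ (y + z)
    *-nonneg     : ∀ x y → 0# ≤ x → 0# ≤ y → 0# ≤ (x * y)
    nontrivial   : ¬ (1# ≈ 0#)
    inverse      : ∀ x → ¬ (x ≈ 0#) → ∃ λ y → (x * y) ≈ 1#
    sqrt         : ∀ x → 0# ≤ x → ∃ λ y → (y * y) ≈ x
    oddRoot      : ∀ k (cs : Vec Carrier (suc (k ℕ.+ k))) →
                   ∃ λ x → evalMonic commRing cs x ≈ 0#

sumℕ : ∀ {n} → (Fin n → ℕ) → ℕ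
sumℕ {zero}  f = 0
sumℕ {suc n} f = f zero ℕ.+ sumℕ (λ i → f (suc i))

module _ {c ℓ} (R : CommutativeRing c ℓ) where
  open CommutativeRing R using (Carrier; _+_; 0#)
  sumR : ∀ {n} → (Fin n → Carrier) → Carrier
  sumR {zero}  f = 0#
  sumR {suc n} f = f zero + sumR (λ i → f (suc i))

record Graph (n : ℕ) : Set where
  field
    adj       : Fin n → Fin n → Bool
    symmetric : ∀ u v → adj u v ≡ adj v u
    loopless  : ∀ v → adj v v ≡ false
open Graph public

bit : Bool → ℕ
bit true  = 1
bit false = 0

deg : ∀ {n} → Graph n → Fin n → ℕ
deg G v = sumℕ (λ u → bit (adj G v u))

nbrDegSum : ∀ {n} → Graph n → Fin n → ℕ
nbrDegSum G v = sumℕ (λ u → bit (adj G v u) ℕ.* deg G u)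

data Walk {n} (G : Graph n) : Fin n → Fin n → Set where
  here : ∀ {u} → Walk G u u
  step : ∀ {u w v} → adj G u w ≡ true → Walk G w v → Walk G u v

Connected : ∀ {n} → Graph n → Set
Connected {n} G = Fin n × (∀ u v → Walk G u v)

module _ {c ℓ} (R : RealClosedField c ℓ) where
  open RealClosedField R using (Carrier; _≈_; _*_; 0#; 1#; commRing)

  bitR : Bool → Carrier
  bitR true  = 1#
  bitR false = 0#

  adjMul : ∀ {n} → Graph n → (Fin n → Carrier) → Fin n → Carrier
  adjMul G x v = sumR commRing (λ u → bitR (adj G v u) * x u)

  IsEigenvector : ∀ {n} → Graph n → Carrier → (Fin n → Carrier) → Set ℓ
  IsEigenvector G λ' x = (∃ λ i → ¬ (x i ≈ 0#)) × (∀ v → adjMul G x v ≈ (λ' * x v))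

  IsMainEigenvalue : ∀ {n} → Graph n → Carrier → Set (c ⊔ ℓ)
  IsMainEigenvalue {n} G λ' =
    ∃ λ (x : Fin n → Carrier) → IsEigenvector G λ' x × ¬ (sumR commRing x ≈ 0#)

  ExactlyTwoMainEigenvalues : ∀ {n} → Graph n → Set (c ⊔ ℓ)
  ExactlyTwoMainEigenvalues G =
    Σ Carrier λ θ₁ → Σ Carrier λ θ₂ →
      ¬ (θ₁ ≈ θ₂) × IsMainEigenvalue G θ₁ × IsMainEigenvalue G θ₂ ×
      (∀ μ → IsMainEigenvalue G μ → (μ ≈ θ₁) ⊎ (μ ≈ θ₂))

  InG : ℤ → ℤ → ∀ {n} → Graph n → Set (c ⊔ ℓ)
  InG a b G = Connected G × ExactlyTwoMainEigenvalues G ×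
              (∀ v → + nbrDegSum G v ≡ (a ℤ.* + deg G v) ℤ.+ b)

  NonemptyG : ℤ → ℤ → Set (c ⊔ ℓ)
  NonemptyG a b = ∃ λ n → Σ (Graph n) λ G → InG a b G

-- A k-regular graph has k as its only main eigenvalue: summing Ax = μx over all vertices
-- gives μ Σx = k Σx.  So a graph in 𝒢(a,b) is irregular, with minimum degree δ < maximum
-- degree Δ, and by connectivity some vertex p of degree δ has a neighbour of larger degree.
-- With f(v) = Σ_{u∈N(v)} d(u) = a d(v) + b this gives δ² < f(p) = aδ + b ≤ δΔ ≤ f(v) = aΔ + b
-- for v of degree Δ, hence a ≥ 0.  Then a² + 4b = (a − 2δ)² + 4 + 4(aδ + b − δ² − 1) ≥ 4,
-- and (a,b) = (0,1) would force 1 = f(p) > δ² ≥ 1.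

module Submission where

open import Defs
open import Data.Integer using (ℤ; +_; _+_; _*_; _≤_)
open import Data.Product using (_×_)
open import Relation.Nullary using (¬_)
open import Relation.Binary.PropositionalEquality using (_≡_)

open import Algebra.Bundles using (CommutativeRing)
open import Data.Bool using (true; false)
open import Data.Empty using (⊥-elim)
open import Data.Fin using (Fin; zero; suc)
open import Data.Fin.Properties using (all?; ¬∀⟶∃¬)
open import Data.Integer as ℤ using (_<_; -[1+_]; +≤+; +<+)
import Data.Integer.Properties as ℤ
open import Data.Integer.Tactic.RingSolver using (solve-∀)
open import Data.Nat as ℕ using (ℕ; zero; suc)
import Data.Nat.Properties as ℕ
open import Data.Product using (∃; ∃₂; _,_; proj₁; proj₂)
open import Data.Sum using (_⊎_; inj₁; inj₂)
open import Function using (_∘_)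
open import Relation.Binary.Bundles using (TotalPreorder)
import Relation.Binary.Construct.Flip.EqAndOrd as Flip
import Relation.Binary.PropositionalEquality as ≡
open import Relation.Nullary using (yes; no)
open import Relation.Unary using (Decidable)

module RingSums {c ℓ} (R : CommutativeRing c ℓ) where
  open CommutativeRing R hiding (zero) renaming (_+_ to _+ᴿ_; _*_ to _*ᴿ_)
  open import Algebra.Properties.Semiring.Sum semiring public
  open import Algebra.Properties.Semiring.Mult semiring using (×-homo-+)
  open import Algebra.Properties.Semiring.Mult semiring public
    using () renaming (_×_ to _·_)

  sumR≡sum : ∀ {n} (f : Fin n → Carrier) → sumR R f ≡ sum f
  sumR≡sum {zero}  f = ≡.refl
  sumR≡sum {suc n} f = ≡.cong (f zero +ᴿ_) (sumR≡sum (f ∘ suc))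

  ·1-homo-sumℕ : ∀ {n} (g : Fin n → ℕ) → sumℕ g · 1# ≈ sum (λ i → g i · 1#)
  ·1-homo-sumℕ {zero}  g = refl
  ·1-homo-sumℕ {suc n} g =
    trans (×-homo-+ 1# (g zero) _) (+-congˡ (·1-homo-sumℕ (g ∘ suc)))

module RegularSpectrum {c ℓ} (R : RealClosedField c ℓ) where
  open RealClosedField R hiding (zero) renaming (_+_ to _+ᴿ_; _*_ to _*ᴿ_)
  open RingSums commRing
  open import Relation.Binary.Reasoning.Setoid setoid

  *-cancelʳ-≉0 : ∀ {x y s} → ¬ (s ≈ 0#) → x *ᴿ s ≈ y *ᴿ s → x ≈ y
  *-cancelʳ-≉0 {x} {y} {s} s≉0 xs≈ys with inverse s s≉0
  ... | t , st≈1 = begin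
    x                ≈⟨ *-identityʳ x ⟨
    x *ᴿ 1#          ≈⟨ *-congˡ st≈1 ⟨
    x *ᴿ (s *ᴿ t)    ≈⟨ *-assoc x s t ⟨
    (x *ᴿ s) *ᴿ t    ≈⟨ *-congʳ xs≈ys ⟩
    (y *ᴿ s) *ᴿ t    ≈⟨ *-assoc y s t ⟩
    y *ᴿ (s *ᴿ t)    ≈⟨ *-congˡ st≈1 ⟩
    y *ᴿ 1#          ≈⟨ *-identityʳ y ⟩
    y                ∎

  bitR≈bit·1 : ∀ b → bitR R b ≈ bit b · 1#
  bitR≈bit·1 true  = sym (+-identityʳ 1#)
  bitR≈bit·1 false = refl

  column-sum≈deg : ∀ {n} (G : Graph n) u → sum (λ v → bitR R (adj G v u)) ≈ deg G u · 1#
  column-sum≈deg G u = begin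
    sum (λ v → bitR R (adj G v u))          ≡⟨ sum-cong-≗ (λ v → ≡.cong (bitR R) (symmetric G v u)) ⟩
    sum (λ v → bitR R (adj G u v))          ≈⟨ sum-cong-≋ (λ v → bitR≈bit·1 (adj G u v)) ⟩
    sum (λ v → bit (adj G u v) · 1#)        ≈⟨ ·1-homo-sumℕ (λ v → bit (adj G u v)) ⟨
    deg G u · 1#                            ∎

  regular⇒main-eigenvalue≈degree : ∀ {n} (G : Graph n) {k} → (∀ u → deg G u ≡ k) →
                                   ∀ {μ} → IsMainEigenvalue R G μ → μ ≈ k · 1#
  regular⇒main-eigenvalue≈degree G {k} regular {μ} (x , (_ , Ax≈μx) , Σx≉0) =
    *-cancelʳ-≉0 Σx≉0 (begin
      μ *ᴿ sumR commRing x                    ≡⟨ ≡.cong (μ *ᴿ_) (sumR≡sum x) ⟩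
      μ *ᴿ sum x                              ≈⟨ *-distribˡ-sum μ x ⟩
      sum (λ v → μ *ᴿ x v)                    ≈⟨ sum-cong-≋ Ax≈μx ⟨
      sum (adjMul R G x)                      ≡⟨ sum-cong-≗ (λ v → sumR≡sum (λ u → A v u *ᴿ x u)) ⟩
      sum (λ v → sum (λ u → A v u *ᴿ x u))    ≈⟨ ∑-comm (λ v u → A v u *ᴿ x u) ⟩
      sum (λ u → sum (λ v → A v u *ᴿ x u))    ≈⟨ sum-cong-≋ (λ u → *-distribʳ-sum (x u) (λ v → A v u)) ⟨
      sum (λ u → sum (λ v → A v u) *ᴿ x u)    ≈⟨ sum-cong-≋ (λ u → *-congʳ (column-sum≈deg G u)) ⟩
      sum (λ u → deg G u · 1# *ᴿ x u)         ≡⟨ sum-cong-≗ (λ u → ≡.cong (λ d → d · 1# *ᴿ x u) (regular u)) ⟩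
      sum (λ u → k · 1# *ᴿ x u)               ≈⟨ *-distribˡ-sum (k · 1#) x ⟨
      k · 1# *ᴿ sum x                         ≡⟨ ≡.cong (k · 1# *ᴿ_) (sumR≡sum x) ⟨
      k · 1# *ᴿ sumR commRing x               ∎)
    where
    A : Fin _ → Fin _ → Carrier
    A v u = bitR R (adj G v u)

  regular⇒¬two-main-eigenvalues : ∀ {n} (G : Graph n) {k} → (∀ u → deg G u ≡ k) →
                                  ¬ ExactlyTwoMainEigenvalues R G
  regular⇒¬two-main-eigenvalues G regular (θ₁ , θ₂ , θ₁≉θ₂ , main₁ , main₂ , _) =
    θ₁≉θ₂ (trans (regular⇒main-eigenvalue≈degree G regular main₁)
                 (sym (regular⇒main-eigenvalue≈degree G regular main₂)))

sumℕ-mono-≤ : ∀ {n} {f g : Fin n → ℕ} → (∀ i → f i ℕ.≤ g i) → sumℕ f ℕ.≤ sumℕ g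
sumℕ-mono-≤ {zero}  f≤g = ℕ.z≤n
sumℕ-mono-≤ {suc n} f≤g = ℕ.+-mono-≤ (f≤g zero) (sumℕ-mono-≤ (f≤g ∘ suc))

sumℕ-mono-< : ∀ {n} {f g : Fin n → ℕ} → (∀ i → f i ℕ.≤ g i) →
              ∀ j → f j ℕ.< g j → sumℕ f ℕ.< sumℕ g
sumℕ-mono-< f≤g zero    fj<gj = ℕ.+-mono-<-≤ fj<gj (sumℕ-mono-≤ (f≤g ∘ suc))
sumℕ-mono-< f≤g (suc j) fj<gj = ℕ.+-mono-≤-< (f≤g zero) (sumℕ-mono-< (f≤g ∘ suc) j fj<gj)

sumℕ-*ʳ : ∀ {n} (f : Fin n → ℕ) k → sumℕ (λ i → f i ℕ.* k) ≡ sumℕ f ℕ.* k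
sumℕ-*ʳ {zero}  f k = ≡.refl
sumℕ-*ʳ {suc n} f k = ≡.trans (≡.cong (f zero ℕ.* k ℕ.+_) (sumℕ-*ʳ (f ∘ suc) k))
                              (≡.sym (ℕ.*-distribʳ-+ k (f zero) (sumℕ (f ∘ suc))))

term≤sumℕ : ∀ {n} (f : Fin n → ℕ) i → f i ℕ.≤ sumℕ f
term≤sumℕ f zero    = ℕ.m≤m+n (f zero) _
term≤sumℕ f (suc i) = ℕ.≤-trans (term≤sumℕ (f ∘ suc) i) (ℕ.m≤n+m _ (f zero))

module _ {a ℓ₁ ℓ₂} (O : TotalPreorder a ℓ₁ ℓ₂) where
  open TotalPreorder O

  minimum-attained : ∀ {n} (f : Fin (suc n) → Carrier) → ∃ λ i → ∀ j → f i ≲ f j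
  minimum-attained {zero}  f = zero , λ { zero → refl }
  minimum-attained {suc n} f with minimum-attained (f ∘ suc)
  ... | i , min with total (f zero) (f (suc i))
  ... | inj₁ f₀≲ = zero , λ { zero → refl ; (suc j) → trans f₀≲ (min j) }
  ... | inj₂ ≲f₀ = suc i , λ { zero → ≲f₀ ; (suc j) → min j }

walk-crosses : ∀ {n p} (G : Graph n) {P : Fin n → Set p} → Decidable P →
               ∀ {x y} → Walk G x y → P x → ¬ P y →
               ∃₂ λ u v → adj G u v ≡ true × P u × ¬ P v
walk-crosses G P? here                    Px ¬Py = ⊥-elim (¬Py Px)
walk-crosses G P? (step {w = w} x~w walk) Px ¬Py with P? w
... | yes Pw = walk-crosses G P? walk Pw ¬Py
... | no ¬Pw = _ , w , x~w , Px , ¬Pw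

module _ {n} (G : Graph n) where

  neighbour⇒deg-positive : ∀ {v u} → adj G v u ≡ true → 1 ℕ.≤ deg G v
  neighbour⇒deg-positive {v} {u} v~u =
    ℕ.≤-trans (ℕ.≤-reflexive (≡.cong bit (≡.sym v~u))) (term≤sumℕ (λ w → bit (adj G v w)) u)

  nbrDegSum-≥ : ∀ {k} → (∀ u → k ℕ.≤ deg G u) → ∀ v → deg G v ℕ.* k ℕ.≤ nbrDegSum G v
  nbrDegSum-≥ {k} k≤deg v =
    ℕ.≤-trans (ℕ.≤-reflexive (≡.sym (sumℕ-*ʳ (λ u → bit (adj G v u)) k)))
              (sumℕ-mono-≤ (λ u → ℕ.*-monoʳ-≤ (bit (adj G v u)) (k≤deg u)))

  nbrDegSum-≤ : ∀ {k} → (∀ u → deg G u ℕ.≤ k) → ∀ v → nbrDegSum G v ℕ.≤ deg G v ℕ.* k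
  nbrDegSum-≤ {k} deg≤k v =
    ℕ.≤-trans (sumℕ-mono-≤ (λ u → ℕ.*-monoʳ-≤ (bit (adj G v u)) (deg≤k u)))
              (ℕ.≤-reflexive (sumℕ-*ʳ (λ u → bit (adj G v u)) k))

  nbrDegSum-> : ∀ {k} → (∀ u → k ℕ.≤ deg G u) → ∀ {v q} → adj G v q ≡ true →
                k ℕ.< deg G q → deg G v ℕ.* k ℕ.< nbrDegSum G v
  nbrDegSum-> {k} k≤deg {v} {q} v~q k<degq =
    ℕ.≤-<-trans (ℕ.≤-reflexive (≡.sym (sumℕ-*ʳ (λ u → bit (adj G v u)) k)))
                (sumℕ-mono-< (λ u → ℕ.*-monoʳ-≤ (bit (adj G v u)) (k≤deg u)) q term<)
    where
    term< : bit (adj G v q) ℕ.* k ℕ.< bit (adj G v q) ℕ.* deg G q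
    term< rewrite v~q = ℕ.+-mono-<-≤ k<degq ℕ.z≤n

module DegreeExtremes {n} (G : Graph (suc n)) where
  private
    minimum = minimum-attained ℕ.≤-totalPreorder (deg G)
    maximum = minimum-attained (Flip.totalPreorder ℕ.≤-totalPreorder) (deg G)

  vmin vmax : Fin (suc n)
  vmin = proj₁ minimum
  vmax = proj₁ maximum

  δ Δ : ℕ
  δ = deg G vmin
  Δ = deg G vmax

  δ≤deg : ∀ u → δ ℕ.≤ deg G u
  δ≤deg = proj₂ minimum

  deg≤Δ : ∀ u → deg G u ℕ.≤ Δ
  deg≤Δ = proj₂ maximum

  private
    hasDegδ? : Decidable (λ u → deg G u ≡ δ)
    hasDegδ? u = deg G u ℕ.≟ δ

  regular-or-ascending-edge : (∀ u v → Walk G u v) →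
    (∀ u → deg G u ≡ δ) ⊎ ∃₂ λ p q → adj G p q ≡ true × deg G p ≡ δ × δ ℕ.< deg G q
  regular-or-ascending-edge walk with all? hasDegδ?
  ... | yes regular = inj₁ regular
  ... | no ¬regular with ¬∀⟶∃¬ _ _ hasDegδ? ¬regular
  ... | v , degv≢δ with walk-crosses G hasDegδ? (walk vmin v) ≡.refl degv≢δ
  ... | p , q , p~q , degp≡δ , degq≢δ =
    inj₂ (p , q , p~q , degp≡δ , ℕ.≤∧≢⇒< (δ≤deg q) (degq≢δ ∘ ≡.sym))

  module AscendingEdge {p q} (p~q : adj G p q ≡ true) (degp≡δ : deg G p ≡ δ)
                       (δ<degq : δ ℕ.< deg G q) where

    δ<Δ : δ ℕ.< Δ
    δ<Δ = ℕ.<-≤-trans δ<degq (deg≤Δ q)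

    1≤δ : 1 ℕ.≤ δ
    1≤δ = ≡.subst (1 ℕ.≤_) degp≡δ (neighbour⇒deg-positive G p~q)

    δ*δ<nbrDegSum : δ ℕ.* δ ℕ.< nbrDegSum G p
    δ*δ<nbrDegSum = ≡.subst (λ d → d ℕ.* δ ℕ.< nbrDegSum G p) degp≡δ
                      (nbrDegSum-> G δ≤deg p~q δ<degq)

    nbrDegSum≤nbrDegSum-vmax : nbrDegSum G p ℕ.≤ nbrDegSum G vmax
    nbrDegSum≤nbrDegSum-vmax = begin
      nbrDegSum G p      ≤⟨ nbrDegSum-≤ G deg≤Δ p ⟩
      deg G p ℕ.* Δ      ≡⟨ ≡.cong (ℕ._* Δ) degp≡δ ⟩
      δ ℕ.* Δ            ≡⟨ ℕ.*-comm δ Δ ⟩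
      Δ ℕ.* δ            ≤⟨ nbrDegSum-≥ G δ≤deg vmax ⟩
      nbrDegSum G vmax   ∎
      where open ℕ.≤-Reasoning

square-nonneg : ∀ i → + 0 ≤ i * i
square-nonneg (+ n) = ≡.subst (+ 0 ≤_) (≡.sym (ℤ.+◃n≡+n (n ℕ.* n))) (+≤+ ℕ.z≤n)
square-nonneg -[1+ n ] = +≤+ ℕ.z≤n

slope-nonneg : ∀ {a b d D} → d < D → a * d + b ≤ a * D + b → + 0 ≤ a
slope-nonneg {+ _}             _   _     = +≤+ ℕ.z≤n
slope-nonneg {a@(-[1+ _ ])} {b} d<D slope =
  ⊥-elim (ℤ.<⇒≱ (ℤ.+-monoˡ-< b (ℤ.*-monoˡ-<-neg a d<D)) slope)

discriminant-identity : ∀ a b d →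
  a * a + + 4 * b ≡ (a ℤ.- + 2 * d) * (a ℤ.- + 2 * d) + + 4 + + 4 * (a * d + b ℤ.- (+ 1 + d * d))
discriminant-identity = solve-∀

discriminant≥4 : ∀ {a b} d → d * d < a * d + b → + 4 ≤ a * a + + 4 * b
discriminant≥4 {a} {b} d gap =
  ≡.subst (+ 4 ≤_) (≡.sym (discriminant-identity a b d))
    (ℤ.+-mono-≤ (ℤ.+-mono-≤ (square-nonneg (a ℤ.- + 2 * d)) (ℤ.≤-refl {+ 4}))
                (ℤ.*-monoˡ-≤-nonNeg (+ 4) (ℤ.i≤j⇒0≤j-i (ℤ.i<j⇒suc[i]≤j gap))))

¬[a,b]≡[0,1] : ∀ {a b d} → + 1 ≤ d * d → d * d < a * d + b → ¬ (a ≡ + 0 × b ≡ + 1)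
¬[a,b]≡[0,1] 1≤d*d d*d<1 (≡.refl , ≡.refl) = ℤ.<-irrefl ≡.refl (ℤ.<-≤-trans d*d<1 1≤d*d)

lemma2p2 : ∀ {c ℓ} (R : RealClosedField c ℓ) (a b : ℤ) → NonemptyG R a b →
    (+ 0 ≤ a) × (+ 4 ≤ a * a + + 4 * b) × ¬ (a ≡ + 0 × b ≡ + 1)
lemma2p2 R a b (zero , G , (() , _) , _)
lemma2p2 R a b (suc n , G , (_ , walk) , twoMain , f≡ad+b)
  with DegreeExtremes.regular-or-ascending-edge G walk
... | inj₁ regular = ⊥-elim (RegularSpectrum.regular⇒¬two-main-eigenvalues R G regular twoMain)
... | inj₂ (p , q , p~q , degp≡δ , δ<degq) =
  slope-nonneg (+<+ δ<Δ) slope , discriminant≥4 {a} {b} (+ δ) gap , ¬[a,b]≡[0,1] 1≤δ*δ gap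
  where
  open DegreeExtremes G
  open AscendingEdge p~q degp≡δ δ<degq

  fp≡aδ+b : + nbrDegSum G p ≡ a * + δ + b
  fp≡aδ+b = ≡.subst (λ d → + nbrDegSum G p ≡ a * + d + b) degp≡δ (f≡ad+b p)

  slope : a * + δ + b ≤ a * + Δ + b
  slope = ≡.subst₂ _≤_ fp≡aδ+b (f≡ad+b vmax) (+≤+ nbrDegSum≤nbrDegSum-vmax)

  gap : + δ * + δ < a * + δ + b
  gap = ≡.subst₂ _<_ (ℤ.pos-* δ δ) fp≡aδ+b (+<+ δ*δ<nbrDegSum)

  1≤δ*δ : + 1 ≤ + δ * + δ
  1≤δ*δ = ≡.subst (+ 1 ≤_) (ℤ.pos-* δ δ) (+≤+ (ℕ.*-mono-≤ 1≤δ 1≤δ))
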